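{- Let $G$ be a finite group whose prime graph is a null graph (has no edges). Then $\mathcal{P}_e(G)$ is a chordal graph and a cograph.
   Context: The prime graph of a finite group $G$ is the simple graph whose vertices are the prime divisors of $|G|$, with distinct primes $p,q$ adjacent if $G$ has an element of order $pq$. For a finite group $G$, the enhanced power graph $\mathcal{P}_e(G)$ is the simple graph with vertex set $G$ in which two distinct vertices $x,y$ are adjacent if and only if $\langle x,y\rangle$ is cyclic. A graph is chordal if it has no induced cycle of length greater than $3$; it is a cograph if it has no induced subgraph isomorphic to the path $P_4$ on four vertices. -}

module Defs where

open import Data.Nat using (ℕ; zero; suc; _*_; _≤_; _<_)
open import Data.Nat.Divisibility using (_∣_)
open import Data.Nat.Primality using (Prime)
open import Data.Integer using (ℤ; +_; -[1+_])
open import Data.Fin using (Fin; toℕ)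
open import Data.Product using (Σ; ∃; _×_)
open import Data.Sum using (_⊎_)
open import Relation.Nullary using (¬_)
open import Relation.Binary.PropositionalEquality using (_≡_; _≢_)
open import Algebra.Structures using (IsGroup)
open import Function.Definitions using (Injective)

-- A finite group: the carrier is Fin n (every finite group is
-- isomorphic to one of this form), with propositional equality.

record FiniteGroup : Set where
  field
    n       : ℕ
    _∙_     : Fin n → Fin n → Fin n
    e       : Fin n
    _⁻¹     : Fin n → Fin n
    isGroup : IsGroup _≡_ _∙_ e _⁻¹

module _ (G : FiniteGroup) where
  open FiniteGroup G

  ∣G∣ : ℕ
  ∣G∣ = n

  Elt : Set
  Elt = Fin n

  pow : Elt → ℕ → Elt
  pow g zero    = e
  pow g (suc k) = g ∙ pow g k

  zpow : Elt → ℤ → Elt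
  zpow g (+ k)     = pow g k
  zpow g -[1+ k ]  = (pow g (suc k)) ⁻¹

  HasOrder : Elt → ℕ → Set
  HasOrder g k = 1 ≤ k × pow g k ≡ e × (∀ m → 1 ≤ m → m < k → pow g m ≢ e)

  PrimeGraphNull : Set
  PrimeGraphNull = ∀ p q → Prime p → Prime q → p ∣ ∣G∣ → q ∣ ∣G∣ → p ≢ q →
                   ¬ (∃ λ g → HasOrder g (p * q))

  data ⟨_,_⟩∋_ (x y : Elt) : Elt → Set where
    gen-x : ⟨ x , y ⟩∋ x
    gen-y : ⟨ x , y ⟩∋ y
    gen-e : ⟨ x , y ⟩∋ e
    gen-⁻¹ : ∀ {a} → ⟨ x , y ⟩∋ a → ⟨ x , y ⟩∋ (a ⁻¹)
    gen-∙ : ∀ {a b} → ⟨ x , y ⟩∋ a → ⟨ x , y ⟩∋ b → ⟨ x , y ⟩∋ (a ∙ b)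

  CyclicGen : Elt → Elt → Set
  CyclicGen x y = ∃ λ z → ⟨ x , y ⟩∋ z × (∀ w → ⟨ x , y ⟩∋ w → ∃ λ (k : ℤ) → w ≡ zpow z k)

  -- adjacency in the enhanced power graph P_e(G) (vertex set G)
  Adj : Elt → Elt → Set
  Adj x y = x ≢ y × CyclicGen x y

  -- consecutive positions on a cycle of length k
  Consec : ∀ {k} → Fin k → Fin k → Set
  Consec {k} i j = toℕ j ≡ suc (toℕ i) ⊎ toℕ i ≡ suc (toℕ j)
                 ⊎ (toℕ i ≡ 0 × suc (toℕ j) ≡ k) ⊎ (toℕ j ≡ 0 × suc (toℕ i) ≡ k)

  -- P_e(G) is chordal: no induced cycle of length k = m + 4 ≥ 4
  Chordal : Set
  Chordal = ∀ m (v : Fin (suc (suc (suc (suc m)))) → Elt) → Injective _≡_ _≡_ v →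
            ¬ (∀ i j → (Adj (v i) (v j) → Consec i j) × (Consec i j → Adj (v i) (v j)))

  Cograph : Set
  Cograph = ∀ a b c d → a ≢ b → a ≢ c → a ≢ d → b ≢ c → b ≢ d → c ≢ d →
            ¬ (Adj a b × Adj b c × Adj c d × ¬ Adj a c × ¬ Adj a d × ¬ Adj b d)

-- When the prime graph is null, every element order N has at most one prime divisor: two
-- distinct primes p, q ∣ N would give an element of order p q, and p, q ∣ |G| by Lagrange.
-- The divisors of such an N form a chain, and ⟨gᵃ⟩ = ⟨g^gcd(a,N)⟩ by Bézout, so the subgroups
-- of a cyclic group of order N form a chain. Hence two vertices of P_e(G) are adjacent exactly
-- when one is a power of the other, and two powers of a common element are comparable in this
-- sense. So the middle vertex b of an induced path a – b – c is a power of both a and c. An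
-- induced path a – b – c – d then gives c ∈ ⟨b⟩ ⊆ ⟨a⟩, and an induced cycle v₀ v₁ … vₗ of
-- length at least 4 gives v₁ ∈ ⟨v₀⟩ ⊆ ⟨vₗ⟩: both are chords.

module Submission where

open import Defs

open import Algebra.Bundles using (Group)
open import Algebra.Structures using (IsGroup)
import Algebra.Properties.Group as GroupProperties
import Algebra.Properties.Quasigroup as QuasigroupProperties
open import Data.Bool.Base using (Bool; true; false; _∧_; not; if_then_else_)
open import Data.Bool.Properties using (∧-zeroʳ; ∧-identityʳ)
open import Data.Empty using (⊥-elim)
open import Data.Fin.Base using (Fin; zero; suc; toℕ; fromℕ; fromℕ<)
open import Data.Fin.Patterns using (0F; 1F; 2F)
open import Data.Fin.Properties
  using (pigeonhole; any?; suc-injective; toℕ-injective; toℕ<n; toℕ-fromℕ; toℕ-fromℕ<; _≟_)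
open import Data.Integer.Base using (ℤ; +_; -[1+_])
open import Data.List.Base using ([]; _∷_)
open import Data.List.Relation.Unary.All using (_∷_)
open import Data.Nat.Base
  using (ℕ; zero; suc; _+_; _*_; _∸_; _≤_; _<_; z≤n; s≤s; s≤s⁻¹; NonZero; ≢-nonZero; ≢-nonZero⁻¹)
import Data.Nat.Properties as ℕ
open import Data.Nat.Properties
  using ( +-suc; *-comm; *-assoc; *-identityˡ; *-zeroʳ; *-mono-≤; *-monoˡ-<
        ; ≤-refl; ≤-reflexive; ≤-trans; <⇒≤; <-≤-trans; ≤-<-trans; <-cmp; _≤?_
        ; n≤0⇒n≡0; m≤n+m; n<1+n; m∸n+n≡m; m∸n≤m; m<n⇒0<n∸m; anyUpTo?)
open import Data.Nat.Coprimality using (Coprime; coprime-divisor)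
open import Data.Nat.Divisibility
  using (_∣_; divides; ∣-refl; ∣-trans; _∣0; ∣m∣n⇒∣m+n; 0∣⇒≡0; ∣1⇒≡1; m∣m*n; *-monoˡ-∣; *-cancelʳ-∣)
open import Data.Nat.DivMod using (_%_; _/_; m≡m%n+[m/n]*n; m%n<n)
open import Data.Nat.GCD
  using (module Bézout; gcd; gcd-GCD; gcd[m,n]∣m; gcd[m,n]∣n; gcd[m,n]≢0; gcd-greatest)
open import Data.Nat.ListAction using (product)
open import Data.Nat.Primality using (Prime; prime⇒irreducible; ¬prime[1])
open import Data.Nat.Primality.Factorisation using (factorise)
open import Data.Product using (∃; _×_; _,_; proj₁; proj₂)
open import Data.Sum using (_⊎_; inj₁; inj₂)
open import Function.Base using (_∘_; case_of_)
open import Function.Definitions using (Injective)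
open import Relation.Binary.Definitions using (tri<; tri≈; tri>)
open import Relation.Binary.PropositionalEquality
open import Relation.Nullary using (¬_; yes; no; _×-dec_; contradiction)
open import Relation.Nullary.Decidable using (does; dec-true; dec-false)
open import Relation.Unary using (Pred; Decidable)

AtMostOnePrimeDivisor : ℕ → Set
AtMostOnePrimeDivisor N = ∀ {p q} → Prime p → Prime q → p ∣ N → q ∣ N → p ≡ q

prime-divisor : ∀ m → .{{NonZero m}} → m ≢ 1 → ∃ λ p → Prime p × p ∣ m
prime-divisor m m≢1 with factorise m
... | record { factors = [] ; isFactorisation = m≡1 } = contradiction m≡1 m≢1
... | record { factors = p ∷ ps ; isFactorisation = m≡p*ps ; factorsPrime = prime-p ∷ _ } =
  p , prime-p , subst (p ∣_) (sym m≡p*ps) (m∣m*n (product ps))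

distinct-primes-coprime : ∀ {p q} → Prime p → Prime q → p ≢ q → Coprime p q
distinct-primes-coprime {p} prime-p prime-q p≢q {i} (i∣p , i∣q)
  with prime⇒irreducible prime-p i∣p | prime⇒irreducible prime-q i∣q
... | inj₁ i≡1 | _        = i≡1
... | inj₂ _   | inj₁ i≡1 = i≡1
... | inj₂ i≡p | inj₂ i≡q = contradiction (trans (sym i≡p) i≡q) p≢q

distinct-primes-*-∣ : ∀ {p q N} → Prime p → Prime q → p ≢ q → p ∣ N → q ∣ N → p * q ∣ N
distinct-primes-*-∣ {p} {q} prime-p prime-q p≢q (divides a N≡a*p) q∣N
  with coprime-divisor (distinct-primes-coprime prime-q prime-p (p≢q ∘ sym))
                       (subst (q ∣_) (trans N≡a*p (*-comm a p)) q∣N)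
... | divides b a≡b*q = divides b (begin
  _          ≡⟨ N≡a*p ⟩
  a * p      ≡⟨ cong (_* p) a≡b*q ⟩
  b * q * p  ≡⟨ *-assoc b q p ⟩
  b * (q * p) ≡⟨ cong (b *_) (*-comm q p) ⟩
  b * (p * q) ∎)
  where open ≡-Reasoning

divisor≢0 : ∀ {u N} .{{_ : NonZero N}} → u ∣ N → u ≢ 0
divisor≢0 {N = N} u∣N refl = ≢-nonZero⁻¹ N (0∣⇒≡0 u∣N)

divisors-comparable : ∀ {N u v} .{{_ : NonZero N}} → AtMostOnePrimeDivisor N →
                      u ∣ N → v ∣ N → u ∣ v ⊎ v ∣ u
divisors-comparable {N} {u} {v} one u∣N v∣N
  with gcd[m,n]∣m u v | gcd[m,n]∣n u v
... | divides 0 u≡0 | _ = contradiction u≡0 (divisor≢0 u∣N)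
... | divides 1 u≡d | _ = inj₁ (subst (_∣ v) (sym (trans u≡d (*-identityˡ _))) (gcd[m,n]∣n u v))
... | _ | divides 0 v≡0 = contradiction v≡0 (divisor≢0 v∣N)
... | _ | divides 1 v≡d = inj₂ (subst (_∣ u) (sym (trans v≡d (*-identityˡ _))) (gcd[m,n]∣m u v))
... | divides u′@(suc (suc _)) u≡u′*d | divides v′@(suc (suc _)) v≡v′*d
  with prime-divisor u′ (λ ()) | prime-divisor v′ (λ ())
... | p , prime-p , p∣u′ | q , prime-q , q∣v′ = ⊥-elim (¬prime[1] (subst Prime p≡1 prime-p))
  where
  d : ℕ
  d = gcd u v
  p≡q : p ≡ q
  p≡q = one prime-p prime-q
    (∣-trans p∣u′ (∣-trans (divides d (trans u≡u′*d (*-comm u′ d))) u∣N))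
    (∣-trans q∣v′ (∣-trans (divides d (trans v≡v′*d (*-comm v′ d))) v∣N))
  -- p divides both u / d and v / d, so p d divides d
  p*d∣d : p * d ∣ 1 * d
  p*d∣d = subst (p * d ∣_) (sym (*-identityˡ d)) (gcd-greatest
    (subst (p * d ∣_) (sym u≡u′*d) (*-monoˡ-∣ d p∣u′))
    (subst (p * d ∣_) (sym v≡v′*d) (*-monoˡ-∣ d (subst (_∣ v′) (sym p≡q) q∣v′))))
  p≡1 : p ≡ 1
  p≡1 = ∣1⇒≡1 (*-cancelʳ-∣ d ⦃ ≢-nonZero (gcd[m,n]≢0 u v (inj₁ (divisor≢0 u∣N))) ⦄ p*d∣d)

least-witness : ∀ {p} {P : Pred ℕ p} → Decidable P → ∀ {m} → P m →
                ∃ λ k → P k × (∀ {j} → j < k → ¬ P j)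
least-witness {P = P} P? {m} Pm = least-below (suc m) (m , ≤-refl , Pm)
  where
  least-below : ∀ v → (∃ λ n → n < v × P n) → ∃ λ k → P k × (∀ {j} → j < k → ¬ P j)
  least-below (suc v) (n , n<1+v , Pn) with anyUpTo? P? v
  ... | yes below-v = least-below v below-v
  ... | no none     = n , Pn , λ j<n Pj → none (_ , <-≤-trans j<n (s≤s⁻¹ n<1+v) , Pj)

count : ∀ {n} → (Fin n → Bool) → ℕ
count {zero}  P = 0
count {suc n} P = if P zero then suc (count (P ∘ suc)) else count (P ∘ suc)

count-cong : ∀ {n} {P Q : Fin n → Bool} → (∀ x → P x ≡ Q x) → count P ≡ count Q
count-cong {zero}  P≗Q = refl
count-cong {suc n} P≗Q rewrite P≗Q zero | count-cong (P≗Q ∘ suc) = refl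

count-true : ∀ n → count {n} (λ _ → true) ≡ n
count-true zero    = refl
count-true (suc n) = cong suc (count-true n)

count-false : ∀ {n} {P : Fin n → Bool} → (∀ x → P x ≡ false) → count P ≡ 0
count-false {zero}  P≗false = refl
count-false {suc n} P≗false rewrite P≗false zero = count-false (P≗false ∘ suc)

count-partition : ∀ {n} (P Q : Fin n → Bool) →
                  count P ≡ count (λ x → P x ∧ Q x) + count (λ x → P x ∧ not (Q x))
count-partition {zero}  P Q = refl
count-partition {suc n} P Q with P zero | Q zero | count-partition (P ∘ suc) (Q ∘ suc)
... | true  | true  | rest = cong suc rest
... | true  | false | rest = trans (cong suc rest) (sym (+-suc _ _))
... | false | _     | rest = rest

count≢0⇒witness : ∀ {n} (P : Fin n → Bool) → count P ≢ 0 → ∃ λ x → P x ≡ true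
count≢0⇒witness {zero}  P count≢0 = contradiction refl count≢0
count≢0⇒witness {suc n} P count≢0 with P zero in P0
... | true  = zero , P0
... | false with count≢0⇒witness (P ∘ suc) count≢0
...   | x , Px = suc x , Px

count-≟ : ∀ {n} (c : Fin n) → count (λ x → does (c ≟ x)) ≡ 1
count-≟ {suc n} zero    = cong suc (count-false {n} (λ _ → refl))
count-≟ {suc n} (suc c) = count-≟ c

image : ∀ {m n} → (Fin m → Fin n) → Fin n → Bool
image f y = does (any? λ i → f i ≟ y)

image-intro : ∀ {m n} (f : Fin m → Fin n) i → image f (f i) ≡ true
image-intro f i = dec-true (any? λ j → f j ≟ f i) (i , refl)

image-elim : ∀ {m n} (f : Fin m → Fin n) {y} → image f y ≡ true → ∃ λ i → f i ≡ y
image-elim f {y} y∈f with any? (λ i → f i ≟ y)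
... | yes preimage = preimage
... | no  _        = contradiction y∈f λ ()

count-image : ∀ {m n} (f : Fin m → Fin n) → Injective _≡_ _≡_ f → count (image f) ≡ m
count-image {zero}  f f-inj = count-false {P = image f} (λ _ → refl)
count-image {suc m} f f-inj = begin
  count (image f)
    ≡⟨ count-partition (image f) (λ y → does (f zero ≟ y)) ⟩
  count (λ y → image f y ∧ does (f zero ≟ y)) + count (λ y → image f y ∧ not (does (f zero ≟ y)))
    ≡⟨ cong₂ _+_ (count-cong hit) (count-cong miss) ⟩
  count (λ y → does (f zero ≟ y)) + count (image (f ∘ suc))
    ≡⟨ cong₂ _+_ (count-≟ (f zero)) (count-image (f ∘ suc) (suc-injective ∘ f-inj)) ⟩
  suc m
    ∎
  where
  open ≡-Reasoning
  hit : ∀ y → image f y ∧ does (f zero ≟ y) ≡ does (f zero ≟ y)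
  hit y with f zero ≟ y
  ... | yes _ = refl
  ... | no  _ = ∧-zeroʳ _
  miss : ∀ y → image f y ∧ not (does (f zero ≟ y)) ≡ image (f ∘ suc) y
  miss y with f zero ≟ y
  ... | no  _    = ∧-identityʳ _
  ... | yes refl = sym (dec-false (any? λ i → f (suc i) ≟ f zero) λ (i , f[1+i]≡f0) →
                                  contradiction (f-inj f[1+i]≡f0) λ ())

module _ (G : FiniteGroup) where
  open FiniteGroup G
  open IsGroup isGroup using (assoc; identityˡ; identityʳ)

  private
    group : Group _ _
    group = record { isGroup = isGroup }
    open GroupProperties group using (inverseˡ-unique; inverseʳ-unique; \\-leftDividesʳ; quasigroup)
    open QuasigroupProperties quasigroup using (cancelʳ)

  infixr 30 _^_
  _^_ : Elt G → ℕ → Elt G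
  _^_ = pow G

  ^-+ : ∀ g a b → g ^ (a + b) ≡ g ^ a ∙ g ^ b
  ^-+ g zero    b = sym (identityˡ _)
  ^-+ g (suc a) b = trans (cong (g ∙_) (^-+ g a b)) (sym (assoc g _ _))

  ^-* : ∀ g a b → (g ^ a) ^ b ≡ g ^ (b * a)
  ^-* g a zero    = refl
  ^-* g a (suc b) = trans (cong (g ^ a ∙_) (^-* g a b)) (sym (^-+ g a (b * a)))

  e^ : ∀ k → e ^ k ≡ e
  e^ zero    = refl
  e^ (suc k) = trans (cong (e ∙_) (e^ k)) (identityˡ e)

  ^-multiple-of-period : ∀ {g N} k → g ^ N ≡ e → g ^ (k * N) ≡ e
  ^-multiple-of-period {g} {N} k gᴺ≡e = begin
    g ^ (k * N)  ≡⟨ ^-* g N k ⟨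
    (g ^ N) ^ k  ≡⟨ cong (_^ k) gᴺ≡e ⟩
    e ^ k        ≡⟨ e^ k ⟩
    e            ∎
    where open ≡-Reasoning

  ^-% : ∀ {g N} .{{_ : NonZero N}} → g ^ N ≡ e → ∀ k → g ^ (k % N) ≡ g ^ k
  ^-% {g} {N} gᴺ≡e k = sym (begin
    g ^ k                            ≡⟨ cong (g ^_) (m≡m%n+[m/n]*n k N) ⟩
    g ^ (k % N + k / N * N)          ≡⟨ ^-+ g (k % N) (k / N * N) ⟩
    g ^ (k % N) ∙ g ^ (k / N * N)    ≡⟨ cong (g ^ (k % N) ∙_) (^-multiple-of-period (k / N) gᴺ≡e) ⟩
    g ^ (k % N) ∙ e                  ≡⟨ identityʳ _ ⟩
    g ^ (k % N)                      ∎)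
    where open ≡-Reasoning

  ^-⁻¹ : ∀ {g N} m → g ^ suc N ≡ e → (g ^ m) ⁻¹ ≡ g ^ (N * m)
  ^-⁻¹ {g} {N} m gᴺ⁺¹≡e = sym (inverseʳ-unique (g ^ m) (g ^ (N * m)) (begin
    g ^ m ∙ g ^ (N * m)  ≡⟨ ^-+ g m (N * m) ⟨
    g ^ (suc N * m)      ≡⟨ cong (g ^_) (*-comm (suc N) m) ⟩
    g ^ (m * suc N)      ≡⟨ ^-multiple-of-period m gᴺ⁺¹≡e ⟩
    e                    ∎))
    where open ≡-Reasoning

  ^-≡⇒period : ∀ g {a b} → a < b → g ^ a ≡ g ^ b → g ^ (b ∸ a) ≡ e
  ^-≡⇒period g {a} {b} a<b gᵃ≡gᵇ = cancelʳ (g ^ a) (g ^ (b ∸ a)) e (begin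
    g ^ (b ∸ a) ∙ g ^ a  ≡⟨ ^-+ g (b ∸ a) a ⟨
    g ^ (b ∸ a + a)      ≡⟨ cong (g ^_) (m∸n+n≡m (<⇒≤ a<b)) ⟩
    g ^ b                ≡⟨ gᵃ≡gᵇ ⟨
    g ^ a                ≡⟨ identityˡ (g ^ a) ⟨
    e ∙ g ^ a            ∎)
    where open ≡-Reasoning

  has-period : ∀ g → ∃ λ N → 1 ≤ N × g ^ N ≡ e
  has-period g with pigeonhole (n<1+n n) (λ i → g ^ toℕ i)
  ... | i , j , i<j , gⁱ≡gʲ = toℕ j ∸ toℕ i , m<n⇒0<n∸m i<j , ^-≡⇒period g i<j gⁱ≡gʲ

  has-order : ∀ g → ∃ λ N → HasOrder G g N
  has-order g with least-witness (λ k → 1 ≤? k ×-dec g ^ k ≟ e) (proj₂ (has-period g))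
  ... | N , (1≤N , gᴺ≡e) , minimal = N , 1≤N , gᴺ≡e , λ m 1≤m m<N gᵐ≡e → minimal m<N (1≤m , gᵐ≡e)

  ^-distinct-below-order : ∀ {g N} → HasOrder G g N → ∀ {i j} → i < j → j < N → g ^ i ≢ g ^ j
  ^-distinct-below-order {g} (_ , _ , minimal) {i} {j} i<j j<N gⁱ≡gʲ =
    minimal (j ∸ i) (m<n⇒0<n∸m i<j) (≤-<-trans (m∸n≤m j i) j<N) (^-≡⇒period g i<j gⁱ≡gʲ)

  ^-injective-below-order : ∀ {g N} → HasOrder G g N →
                            ∀ {a b} → a < N → b < N → g ^ a ≡ g ^ b → a ≡ b
  ^-injective-below-order g-order {a} {b} a<N b<N gᵃ≡gᵇ with <-cmp a b
  ... | tri< a<b _ _ = contradiction gᵃ≡gᵇ (^-distinct-below-order g-order a<b b<N)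
  ... | tri≈ _ a≡b _ = a≡b
  ... | tri> _ _ b<a = contradiction (sym gᵃ≡gᵇ) (^-distinct-below-order g-order b<a a<N)

  module Cosets {g N} (g-order : HasOrder G g (suc N)) where
    private
      gᴺ⁺¹≡e : g ^ suc N ≡ e
      gᴺ⁺¹≡e = proj₁ (proj₂ g-order)

    coset : Elt G → Fin (suc N) → Elt G
    coset x i = g ^ toℕ i ∙ x

    coset-injective : ∀ x → Injective _≡_ _≡_ (coset x)
    coset-injective x {i} {j} gⁱx≡gʲx = toℕ-injective
      (^-injective-below-order g-order (toℕ<n i) (toℕ<n j) (cancelʳ x _ _ gⁱx≡gʲx))

    InCoset : Elt G → Elt G → Bool
    InCoset x = image (coset x)

    ^∙-InCoset : ∀ k x → InCoset x (g ^ k ∙ x) ≡ true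
    ^∙-InCoset k x = subst (λ y → InCoset x y ≡ true) gᵏ⁻ᵐᵒᵈx≡gᵏx
                           (image-intro (coset x) (fromℕ< (m%n<n k (suc N))))
      where
      gᵏ⁻ᵐᵒᵈx≡gᵏx : coset x (fromℕ< (m%n<n k (suc N))) ≡ g ^ k ∙ x
      gᵏ⁻ᵐᵒᵈx≡gᵏx = cong (_∙ x) (trans (cong (g ^_) (toℕ-fromℕ< (m%n<n k (suc N))))
                                       (^-% {N = suc N} gᴺ⁺¹≡e k))

    InCoset-cancel : ∀ k {x y} → InCoset x (g ^ k ∙ y) ≡ true → InCoset x y ≡ true
    InCoset-cancel k {x} {y} gᵏy∈x with image-elim (coset x) gᵏy∈x
    ... | j , gʲx≡gᵏy = subst (λ z → InCoset x z ≡ true) (sym y≡gᵐx) (^∙-InCoset (N * k + toℕ j) x)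
      where
      open ≡-Reasoning
      y≡gᵐx : y ≡ g ^ (N * k + toℕ j) ∙ x
      y≡gᵐx = begin
        y                                ≡⟨ \\-leftDividesʳ (g ^ k) y ⟨
        ((g ^ k) ⁻¹) ∙ (g ^ k ∙ y)       ≡⟨ cong₂ _∙_ (^-⁻¹ {N = N} k gᴺ⁺¹≡e) (sym gʲx≡gᵏy) ⟩
        g ^ (N * k) ∙ (g ^ toℕ j ∙ x)    ≡⟨ assoc _ _ _ ⟨
        (g ^ (N * k) ∙ g ^ toℕ j) ∙ x    ≡⟨ cong (_∙ x) (^-+ g (N * k) (toℕ j)) ⟨
        g ^ (N * k + toℕ j) ∙ x          ∎

    Invariant : (Elt G → Bool) → Set
    Invariant S = ∀ k {x} → S x ≡ true → S (g ^ k ∙ x) ≡ true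

    invariant-⊇-coset : ∀ {S x} → Invariant S → S x ≡ true → ∀ y → S y ∧ InCoset x y ≡ InCoset x y
    invariant-⊇-coset {S} {x} S-inv Sx y with InCoset x y in y∈x
    ... | false = ∧-zeroʳ (S y)
    ... | true with image-elim (coset x) y∈x
    ...   | i , refl rewrite S-inv (toℕ i) Sx = refl

    invariant-without-coset : ∀ {S} x → Invariant S → Invariant (λ y → S y ∧ not (InCoset x y))
    invariant-without-coset {S} x S-inv k {y} S′y with S y in Sy | InCoset x y in y∈x
    ... | false | _     = contradiction S′y λ ()
    ... | true  | true  = contradiction S′y λ ()
    ... | true  | false = remains
      where
      remains : S (g ^ k ∙ y) ∧ not (InCoset x (g ^ k ∙ y)) ≡ true
      remains rewrite S-inv k Sy with InCoset x (g ^ k ∙ y) in gᵏy∈x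
      ... | false = refl
      ... | true  = contradiction (trans (sym y∈x) (InCoset-cancel k gᵏy∈x)) λ ()

    -- An invariant set is a disjoint union of cosets ⟨g⟩x of size suc N: remove one and recurse.
    invariant-count : ∀ fuel S → Invariant S → count S ≤ fuel → suc N ∣ count S
    invariant-count zero       S S-inv size = subst (suc N ∣_) (sym (n≤0⇒n≡0 size)) (suc N ∣0)
    invariant-count (suc fuel) S S-inv size with count S ℕ.≟ 0
    ... | yes count≡0 = subst (suc N ∣_) (sym count≡0) (suc N ∣0)
    ... | no  count≢0 with count≢0⇒witness S count≢0
    ...   | x , Sx = subst (suc N ∣_) (sym split) (∣m∣n⇒∣m+n ∣-refl rest)
      where
      S′ : Elt G → Bool
      S′ y = S y ∧ not (InCoset x y)
      split : count S ≡ suc N + count S′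
      split = trans (count-partition S (InCoset x))
        (cong (_+ count S′) (trans (count-cong (invariant-⊇-coset S-inv Sx))
                                   (count-image (coset x) (coset-injective x))))
      rest : suc N ∣ count S′
      rest = invariant-count fuel S′ (invariant-without-coset x S-inv)
               (s≤s⁻¹ (≤-trans (s≤s (m≤n+m (count S′) N)) (subst (_≤ suc fuel) split size)))

  order∣∣G∣ : ∀ {g N} → HasOrder G g N → N ∣ ∣G∣ G
  order∣∣G∣ {N = suc N} g-order = subst (suc N ∣_) (count-true n)
    (invariant-count n (λ _ → true) (λ _ _ → refl) (≤-reflexive (count-true n)))
    where open Cosets g-order

  power-order : ∀ {z} c {d} → HasOrder G z (c * d) → HasOrder G (z ^ c) d
  power-order zero    (() , _)
  power-order (suc c) {zero} (1≤c*0 , _) = contradiction (subst (1 ≤_) (*-zeroʳ c) 1≤c*0) λ ()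
  power-order {z} c@(suc _) {d@(suc _)} (_ , zᶜᵈ≡e , minimal) =
    s≤s z≤n , zᶜ^d≡e , λ m 1≤m m<d zᶜ^m≡e →
      minimal (m * c) (*-mono-≤ 1≤m (s≤s z≤n))
              (subst (m * c <_) (*-comm d c) (*-monoˡ-< c m<d))
              (trans (sym (^-* z c m)) zᶜ^m≡e)
    where
    zᶜ^d≡e : (z ^ c) ^ d ≡ e
    zᶜ^d≡e = trans (^-* z c d) (trans (cong (z ^_) (*-comm d c)) zᶜᵈ≡e)

  order-has-one-prime-divisor : PrimeGraphNull G → ∀ {z N} → HasOrder G z N →
                                AtMostOnePrimeDivisor N
  order-has-one-prime-divisor pgn {z} {N} z-order {p} {q} prime-p prime-q p∣N q∣N with p ℕ.≟ q
  ... | yes p≡q = p≡q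
  ... | no  p≢q with distinct-primes-*-∣ prime-p prime-q p≢q p∣N q∣N
  ...   | divides c N≡c*pq =
    contradiction (z ^ c , power-order c (subst (HasOrder G z) N≡c*pq z-order))
                  (pgn p q prime-p prime-q (∣-trans p∣N N∣∣G∣) (∣-trans q∣N N∣∣G∣) p≢q)
    where
    N∣∣G∣ : N ∣ ∣G∣ G
    N∣∣G∣ = order∣∣G∣ z-order

  infix 4 _∈⟨_⟩
  _∈⟨_⟩ : Elt G → Elt G → Set
  x ∈⟨ g ⟩ = ∃ λ k → x ≡ g ^ k

  Comparable : Elt G → Elt G → Set
  Comparable x y = x ∈⟨ y ⟩ ⊎ y ∈⟨ x ⟩

  ∈⟨⟩-refl : ∀ g → g ∈⟨ g ⟩
  ∈⟨⟩-refl g = 1 , sym (identityʳ g)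

  ∈⟨⟩-trans : ∀ {x y g} → x ∈⟨ y ⟩ → y ∈⟨ g ⟩ → x ∈⟨ g ⟩
  ∈⟨⟩-trans {g = g} (k , refl) (j , refl) = k * j , ^-* g j k

  ∈⟨⟩-∙ : ∀ {x y g} → x ∈⟨ g ⟩ → y ∈⟨ g ⟩ → x ∙ y ∈⟨ g ⟩
  ∈⟨⟩-∙ {g = g} (k , refl) (j , refl) = k + j , sym (^-+ g k j)

  ∈⟨⟩-⁻¹ : ∀ {x g} → x ∈⟨ g ⟩ → x ⁻¹ ∈⟨ g ⟩
  ∈⟨⟩-⁻¹ {g = g} (k , refl) with has-order g
  ... | suc N , _ , gᴺ⁺¹≡e , _ = N * k , ^-⁻¹ {N = N} k gᴺ⁺¹≡e

  ∣⇒^-∈⟨⟩ : ∀ g {a b} → a ∣ b → g ^ b ∈⟨ g ^ a ⟩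
  ∣⇒^-∈⟨⟩ g {a} (divides k refl) = k , sym (^-* g a k)

  ^-gcd-∈⟨⟩ : ∀ {g N} b → g ^ N ≡ e → g ^ gcd b N ∈⟨ g ^ b ⟩
  ^-gcd-∈⟨⟩ {g} {N} b gᴺ≡e with Bézout.identity (gcd-GCD b N)
  ... | Bézout.+- x y d+yN≡xb = x , (begin
    g ^ d                ≡⟨ identityʳ _ ⟨
    g ^ d ∙ e            ≡⟨ cong (g ^ d ∙_) (^-multiple-of-period y gᴺ≡e) ⟨
    g ^ d ∙ g ^ (y * N)  ≡⟨ ^-+ g d (y * N) ⟨
    g ^ (d + y * N)      ≡⟨ cong (g ^_) d+yN≡xb ⟩
    g ^ (x * b)          ≡⟨ ^-* g b x ⟨
    (g ^ b) ^ x          ∎)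
    where
    open ≡-Reasoning
    d : ℕ
    d = gcd b N
  ... | Bézout.-+ x y d+xb≡yN =
    subst (_∈⟨ g ^ b ⟩) (sym gᵈ≡[gˣᵇ]⁻¹) (∈⟨⟩-⁻¹ (∣⇒^-∈⟨⟩ g (divides x refl)))
    where
    open ≡-Reasoning
    d : ℕ
    d = gcd b N
    gᵈ≡[gˣᵇ]⁻¹ : g ^ d ≡ (g ^ (x * b)) ⁻¹
    gᵈ≡[gˣᵇ]⁻¹ = inverseˡ-unique (g ^ d) (g ^ (x * b)) (begin
      g ^ d ∙ g ^ (x * b)  ≡⟨ ^-+ g d (x * b) ⟨
      g ^ (d + x * b)      ≡⟨ cong (g ^_) d+xb≡yN ⟩
      g ^ (y * N)          ≡⟨ ^-multiple-of-period y gᴺ≡e ⟩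
      e                    ∎)

  powers-comparable : ∀ {g N} .{{_ : NonZero N}} → AtMostOnePrimeDivisor N → g ^ N ≡ e →
                      ∀ a b → Comparable (g ^ a) (g ^ b)
  powers-comparable {g} {N} one gᴺ≡e a b
    with divisors-comparable one (gcd[m,n]∣n a N) (gcd[m,n]∣n b N)
  ... | inj₁ gcd[a,N]∣gcd[b,N] = inj₂ (∈⟨⟩-trans (∣⇒^-∈⟨⟩ g (gcd[m,n]∣m b N))
                                 (∈⟨⟩-trans (∣⇒^-∈⟨⟩ g gcd[a,N]∣gcd[b,N]) (^-gcd-∈⟨⟩ a gᴺ≡e)))
  ... | inj₂ gcd[b,N]∣gcd[a,N] = inj₁ (∈⟨⟩-trans (∣⇒^-∈⟨⟩ g (gcd[m,n]∣m a N))
                                 (∈⟨⟩-trans (∣⇒^-∈⟨⟩ g gcd[b,N]∣gcd[a,N]) (^-gcd-∈⟨⟩ b gᴺ≡e)))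

  common-power-comparable : PrimeGraphNull G → ∀ {x y z} → x ∈⟨ z ⟩ → y ∈⟨ z ⟩ → Comparable x y
  common-power-comparable pgn {z = z} (a , refl) (b , refl) with has-order z
  ... | suc N , z-order@(_ , zᴺ⁺¹≡e , _) =
    powers-comparable (order-has-one-prime-divisor pgn z-order) zᴺ⁺¹≡e a b

  zpow-∈⟨⟩ : ∀ g k → zpow G g k ∈⟨ g ⟩
  zpow-∈⟨⟩ g (+ k)    = k , refl
  zpow-∈⟨⟩ g -[1+ k ] = ∈⟨⟩-⁻¹ (suc k , refl)

  ∈⟨⟩⇒zpow : ∀ {x g} → x ∈⟨ g ⟩ → ∃ λ (k : ℤ) → x ≡ zpow G g k
  ∈⟨⟩⇒zpow (k , x≡gᵏ) = + k , x≡gᵏ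

  ⟨⟩-⊆-∈⟨⟩ : ∀ {x y g w} → x ∈⟨ g ⟩ → y ∈⟨ g ⟩ → ⟨_,_⟩∋_ G x y w → w ∈⟨ g ⟩
  ⟨⟩-⊆-∈⟨⟩ x∈g y∈g gen-x         = x∈g
  ⟨⟩-⊆-∈⟨⟩ x∈g y∈g gen-y         = y∈g
  ⟨⟩-⊆-∈⟨⟩ x∈g y∈g gen-e         = 0 , refl
  ⟨⟩-⊆-∈⟨⟩ x∈g y∈g (gen-⁻¹ a)    = ∈⟨⟩-⁻¹ (⟨⟩-⊆-∈⟨⟩ x∈g y∈g a)
  ⟨⟩-⊆-∈⟨⟩ x∈g y∈g (gen-∙ a b)   = ∈⟨⟩-∙ (⟨⟩-⊆-∈⟨⟩ x∈g y∈g a) (⟨⟩-⊆-∈⟨⟩ x∈g y∈g b)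

  comparable⇒Adj : ∀ {x y} → x ≢ y → Comparable x y → Adj G x y
  comparable⇒Adj {x} {y} x≢y (inj₁ x∈y) =
    x≢y , y , gen-y , λ w w∈⟨x,y⟩ → ∈⟨⟩⇒zpow (⟨⟩-⊆-∈⟨⟩ x∈y (∈⟨⟩-refl y) w∈⟨x,y⟩)
  comparable⇒Adj {x} {y} x≢y (inj₂ y∈x) =
    x≢y , x , gen-x , λ w w∈⟨x,y⟩ → ∈⟨⟩⇒zpow (⟨⟩-⊆-∈⟨⟩ (∈⟨⟩-refl x) y∈x w∈⟨x,y⟩)

  Adj⇒common-generator : ∀ {x y} → Adj G x y → ∃ λ g → x ∈⟨ g ⟩ × y ∈⟨ g ⟩
  Adj⇒common-generator (_ , g , _ , generates) with generates _ gen-x | generates _ gen-y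
  ... | k , refl | j , refl = g , zpow-∈⟨⟩ g k , zpow-∈⟨⟩ g j

  Adj⇒comparable : PrimeGraphNull G → ∀ {x y} → Adj G x y → Comparable x y
  Adj⇒comparable pgn x∼y with Adj⇒common-generator x∼y
  ... | _ , x∈z , y∈z = common-power-comparable pgn x∈z y∈z

  induced-path-centre : PrimeGraphNull G → ∀ {a b c} → Adj G a b → Adj G b c → ¬ Adj G a c → a ≢ c →
                        b ∈⟨ a ⟩ × b ∈⟨ c ⟩
  induced-path-centre pgn a∼b b∼c a≁c a≢c with Adj⇒comparable pgn a∼b | Adj⇒comparable pgn b∼c
  ... | inj₂ b∈a | inj₁ b∈c = b∈a , b∈c
  ... | inj₁ a∈b | inj₁ b∈c = ⊥-elim (a≁c (comparable⇒Adj a≢c (inj₁ (∈⟨⟩-trans a∈b b∈c))))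
  ... | inj₁ a∈b | inj₂ c∈b =
    ⊥-elim (a≁c (comparable⇒Adj a≢c (common-power-comparable pgn a∈b c∈b)))
  ... | inj₂ b∈a | inj₂ c∈b = ⊥-elim (a≁c (comparable⇒Adj a≢c (inj₂ (∈⟨⟩-trans c∈b b∈a))))

  cograph : PrimeGraphNull G → Cograph G
  cograph pgn a b c d _ a≢c _ _ b≢d _ (a∼b , b∼c , c∼d , a≁c , _ , b≁d)
    with induced-path-centre pgn a∼b b∼c a≁c a≢c | induced-path-centre pgn b∼c c∼d b≁d b≢d
  ... | b∈a , _ | c∈b , _ = a≁c (comparable⇒Adj a≢c (inj₂ (∈⟨⟩-trans c∈b b∈a)))

  chordal : PrimeGraphNull G → Chordal G
  chordal pgn m v v-inj induced = 1≁last (proj₁ (induced 1F last) v₁∼vₗ)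
    where
    last : Fin (suc (suc (suc (suc m))))
    last = fromℕ (suc (suc (suc m)))
    adjacent : ∀ {i j} → Consec G i j → Adj G (v i) (v j)
    adjacent = proj₂ (induced _ _)
    last∼0 : Consec G last 0F
    last∼0 = inj₂ (inj₂ (inj₂ (refl , cong suc (toℕ-fromℕ _))))
    last≁1 : ¬ Consec G last 1F
    last≁1 (inj₁ ())
    last≁1 (inj₂ (inj₁ ()))
    last≁1 (inj₂ (inj₂ (inj₁ (() , _))))
    last≁1 (inj₂ (inj₂ (inj₂ (() , _))))
    1≁last : ¬ Consec G 1F last
    1≁last (inj₁ ())
    1≁last (inj₂ (inj₁ ()))
    1≁last (inj₂ (inj₂ (inj₁ (() , _))))
    1≁last (inj₂ (inj₂ (inj₂ (() , _))))
    0≁2 : ¬ Consec G 0F 2F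
    0≁2 (inj₁ ())
    0≁2 (inj₂ (inj₁ ()))
    0≁2 (inj₂ (inj₂ (inj₁ (_ , ()))))
    0≁2 (inj₂ (inj₂ (inj₂ (() , _))))
    v₀∈vₗ : v 0F ∈⟨ v last ⟩
    v₀∈vₗ = proj₁ (induced-path-centre pgn (adjacent last∼0) (adjacent (inj₁ refl))
                      (last≁1 ∘ proj₁ (induced last 1F)) (λ eq → case v-inj eq of λ ()))
    v₁∈v₀ : v 1F ∈⟨ v 0F ⟩
    v₁∈v₀ = proj₁ (induced-path-centre pgn (adjacent (inj₁ refl)) (adjacent (inj₁ refl))
                      (0≁2 ∘ proj₁ (induced 0F 2F)) (λ eq → case v-inj eq of λ ()))
    v₁∼vₗ : Adj G (v 1F) (v last)
    v₁∼vₗ = comparable⇒Adj (λ eq → case v-inj eq of λ ()) (inj₁ (∈⟨⟩-trans v₁∈v₀ v₀∈vₗ))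

corollary4p9 : (G : FiniteGroup) → PrimeGraphNull G → Chordal G × Cograph G
corollary4p9 G pgn = chordal G pgn , cograph G pgn
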